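{- Let $A$ be a set and $s\colon M(A)\to L(A)$ a section of $q\colon L(A)\to M(A)$. Then the relation $\le_s$ on $A$ is reflexive, antisymmetric, and total (for all $x,y$, merely $x\le_s y$ or $y\le_s x$).
   Context: Univalent type theory. $L(A)$ is the free monoid on $A$ (finite lists, $x::xs$ for prepending), $M(A)$ the free commutative monoid (finite multisets) with generators $\eta_A$, $\langle x,y\rangle=\eta_A(x)\cdot\eta_A(y)$, and $q$ the monoid homomorphism extending $\eta_A$. A section is $s$ with $q\circ s=\mathrm{id}$. $\mathrm{head}\colon L(A)\to 1+A$ returns $\mathrm{inl}(\ast)$ on the empty list and $\mathrm{inr}(x)$ on $x::xs$. Define $x\le_s y$ to mean $\mathrm{head}(s(\langle x,y\rangle))=\mathrm{inr}(x)$. -}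

module Defs where

open import Level using (Level)
open import Data.Unit using (⊤; tt)
open import Data.Sum using (_⊎_; inj₁; inj₂)
open import Data.List using (List; []; _∷_; [_]; _++_)
open import Data.List.Relation.Binary.Permutation.Propositional using (_↭_)
open import Relation.Binary.PropositionalEquality using (_≡_)

-- L(A) = List A (free monoid).
-- M(A) = free commutative monoid, presented (no quotients in --without-K Agda)
-- as the setoid (List A, _↭_): lists up to permutation.  The quotient map
-- q : L(A) → M(A) is the identity on underlying lists (the class of a list),
-- and η_A x = [ x ].

η : ∀ {a} {A : Set a} → A → List A
η x = [ x ]

⟨_,_⟩ : ∀ {a} {A : Set a} → A → A → List A
⟨ x , y ⟩ = η x ++ η y

-- A section s : M(A) → L(A) of q: a function on representatives that is
-- well defined on M(A) (respects permutation, landing in L(A) with ≡),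
-- and satisfies q ∘ s = id, i.e. s m is in the class m.
record Section {a} (A : Set a) : Set a where
  field
    s          : List A → List A
    s-wd       : ∀ {xs ys} → xs ↭ ys → s xs ≡ s ys
    is-section : ∀ xs → s xs ↭ xs
open Section public

head : ∀ {a} {A : Set a} → List A → ⊤ ⊎ A
head []       = inj₁ tt
head (x ∷ xs) = inj₂ x

_≤[_]_ : ∀ {a} {A : Set a} → A → Section A → A → Set a
x ≤[ σ ] y = head (s σ ⟨ x , y ⟩) ≡ inj₂ x

-- A permutation of the two-element list ⟨ x , y ⟩ starts with x or with y; since
-- ⟨ x , y ⟩ ↭ ⟨ y , x ⟩, the section picks the same list for both orders, so its
-- head decides between x and y independently of the order of the arguments.
module Submission where

open import Defs
open import Data.Sum using (_⊎_; inj₁; inj₂)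
open import Data.Sum.Properties using (inj₂-injective)
open import Data.Product using (_×_; _,_)
open import Data.List using (List; []; _∷_)
open import Data.List.Relation.Unary.Any using (here; there)
open import Data.List.Relation.Binary.Permutation.Propositional using (_↭_; ↭-refl; ↭-sym; swap)
open import Data.List.Relation.Binary.Permutation.Propositional.Properties
  using (∈-resp-↭; ↭-empty-inv)
open import Relation.Binary.PropositionalEquality using (_≡_; refl; sym; trans; cong)

module _ {a} {A : Set a} where

  head-↭-pair : ∀ {x y : A} {xs : List A} → xs ↭ x ∷ y ∷ [] →
                head xs ≡ inj₂ x ⊎ head xs ≡ inj₂ y
  head-↭-pair {xs = []} p with () ← ↭-empty-inv (↭-sym p)
  head-↭-pair {xs = z ∷ _} p with ∈-resp-↭ p (here refl)
  ... | here z≡x         = inj₁ (cong inj₂ z≡x)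
  ... | there (here z≡y) = inj₂ (cong inj₂ z≡y)

  module _ (σ : Section A) where

    head-s-pair : ∀ x y → head (s σ ⟨ x , y ⟩) ≡ inj₂ x ⊎ head (s σ ⟨ x , y ⟩) ≡ inj₂ y
    head-s-pair x y = head-↭-pair (is-section σ ⟨ x , y ⟩)

    s-pair-comm : ∀ x y → s σ ⟨ x , y ⟩ ≡ s σ ⟨ y , x ⟩
    s-pair-comm x y = s-wd σ (swap x y ↭-refl)

    ≤-refl : ∀ x → x ≤[ σ ] x
    ≤-refl x with head-s-pair x x
    ... | inj₁ h = h
    ... | inj₂ h = h

    ≤-antisym : ∀ x y → x ≤[ σ ] y → y ≤[ σ ] x → x ≡ y
    ≤-antisym x y x≤y y≤x =
      inj₂-injective (trans (sym x≤y) (trans (cong head (s-pair-comm x y)) y≤x))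

    ≤-total : ∀ x y → x ≤[ σ ] y ⊎ y ≤[ σ ] x
    ≤-total x y with head-s-pair x y
    ... | inj₁ h = inj₁ h
    ... | inj₂ h = inj₂ (trans (cong head (s-pair-comm y x)) h)

proposition55 : ∀ {a} {A : Set a} (σ : Section A) →
    ((x : A) → x ≤[ σ ] x)
    × ((x y : A) → x ≤[ σ ] y → y ≤[ σ ] x → x ≡ y)
    × ((x y : A) → (x ≤[ σ ] y) ⊎ (y ≤[ σ ] x))
proposition55 σ = ≤-refl σ , ≤-antisym σ , ≤-total σ
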